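{- Let $n\ge3$ and let $M=([n],\mathcal{F})$ be a $\Delta$-matroid with rank function $r_M$. If the maximum $\max_{S\subseteq[n]}(r_M(S)+r_M(S^C))$ is attained only at the two sets $S$ and $S^C$ for some $S\subseteq[n]$, then $S,S^C\in\mathcal{F}$.
   Context: A $\Delta$-matroid on $[n]$ is a family $\mathcal{F}$ of subsets of $[n]$ (bases) such that whenever $A,B\in\mathcal{F}$ and $a\in A\Delta B$, there exists $b\in A\Delta B$ with $A\Delta\{a,b\}\in\mathcal{F}$. Its rank function is $r_M(S)=\max_{B\in\mathcal{F}}(|B\cap S|+|B^C\cap S^C|)$, where $T^C=[n]\setminus T$. -}

module Defs where

open import Data.Nat using (ℕ; _+_; _≤_; _⊔_)
open import Data.Fin using (Fin)
open import Data.Fin.Subset using (Subset; ∁; _∩_; ∣_∣)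
open import Data.List using (List; foldr; map)
open import Data.List.Membership.Propositional using (_∈_)
open import Data.Product using (∃-syntax; _×_)
open import Relation.Binary.PropositionalEquality using (_≡_)

_Δ_ : ∀ {n} → Subset n → Subset n → Subset n
A Δ B = (A ∩ ∁ B) Data.Fin.Subset.∪ (B ∩ ∁ A)

pair : ∀ {n} → Fin n → Fin n → Subset n
pair a b = Data.Fin.Subset.⁅ a ⁆ Data.Fin.Subset.∪ Data.Fin.Subset.⁅ b ⁆

Family : ℕ → Set
Family n = List (Subset n)

IsDeltaMatroid : ∀ {n} → Family n → Set
IsDeltaMatroid {n} F =
  ∀ (A B : Subset n) → A ∈ F → B ∈ F →
  ∀ (a : Fin n) → a Data.Fin.Subset.∈ (A Δ B) →
  ∃[ b ] (b Data.Fin.Subset.∈ (A Δ B) × (A Δ pair a b) ∈ F)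

-- r_M(S) = max_{B ∈ F} (|B ∩ S| + |Bᶜ ∩ Sᶜ|)   (0 for the empty family).
rank : ∀ {n} → Family n → Subset n → ℕ
rank F S = foldr _⊔_ 0 (map (λ B → ∣ B ∩ S ∣ + ∣ ∁ B ∩ ∁ S ∣) F)

rsum : ∀ {n} → Family n → Subset n → ℕ
rsum F S = rank F S + rank F (∁ S)

module Submission where

-- If S ∉ F, take a basis B attaining r(S) and a coordinate x at which B and S differ.
-- Toggling x in S makes B agree with S at one more place, so r(S) rises by one, while
-- r(Sᶜ) falls by at most one; the toggled set is then another maximiser of
-- r(T) + r(Tᶜ), distinct from S and Sᶜ as soon as n ≥ 2.

open import Defs
open import Data.Bool using (true; false; not)
open import Data.Bool.Properties using (not-involutive; not-¬) renaming (_≟_ to _≟ᵇ_)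
open import Data.Fin using (Fin; zero; suc; punchIn)
open import Data.Fin.Properties using (all?; ¬∀⟶∃¬; punchInᵢ≢i)
open import Data.Fin.Subset using (Subset; ∁; _∩_; ∣_∣)
open import Data.List using ([]; _∷_)
open import Data.List.Membership.Propositional using (_∈_)
open import Data.List.Relation.Unary.Any using (here; there)
open import Data.Nat using (ℕ; suc; _+_; _≤_; z≤n; s≤s; s≤s⁻¹)
open import Data.Nat.Properties
open import Data.Product using (_×_; _,_; ∃-syntax)
open import Data.Sum using (_⊎_; inj₁; inj₂; swap; map₁)
open import Data.Vec using ([]; _∷_; lookup; map; tabulate; updateAt)
open import Data.Vec.Properties
  using (lookup∘updateAt; lookup∘updateAt′; lookup-map; map-updateAt; map-∘; map-cong;
         map-id; updateAt-updateAt-local; updateAt-id; tabulate∘lookup; tabulate-cong)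
open import Function using (_∘_; id)
open import Relation.Nullary using (yes; no; contradiction)
open import Relation.Binary.PropositionalEquality
  using (_≡_; _≢_; refl; sym; trans; cong; subst; module ≡-Reasoning)

private
  variable
    n : ℕ

∁-involutive : (S : Subset n) → ∁ (∁ S) ≡ S
∁-involutive S = begin
  map not (map not S) ≡⟨ map-∘ not not S ⟨
  map (not ∘ not) S   ≡⟨ map-cong not-involutive S ⟩
  map id S            ≡⟨ map-id S ⟩
  S                   ∎
  where open ≡-Reasoning

toggle : Fin n → Subset n → Subset n
toggle x S = updateAt S x not

toggle-involutive : (x : Fin n) (S : Subset n) → toggle x (toggle x S) ≡ S
toggle-involutive x S =
  trans (updateAt-updateAt-local x S (not-involutive (lookup S x))) (updateAt-id x S)

∁-toggle : (x : Fin n) (S : Subset n) → ∁ (toggle x S) ≡ toggle x (∁ S)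
∁-toggle x S = map-updateAt S x refl

toggle≢ : (x : Fin n) (S : Subset n) → toggle x S ≢ S
toggle≢ x S eq = not-¬ refl (trans (cong (λ T → lookup T x) (sym eq)) (lookup∘updateAt x S))

toggle≢∁ : (x : Fin (suc (suc n))) (S : Subset (suc (suc n))) → toggle x S ≢ ∁ S
toggle≢∁ {n} x S eq = not-¬ refl (begin
  lookup S y            ≡⟨ lookup∘updateAt′ y x (punchInᵢ≢i x zero) S ⟨
  lookup (toggle x S) y ≡⟨ cong (λ T → lookup T y) eq ⟩
  lookup (∁ S) y        ≡⟨ lookup-map y not S ⟩
  not (lookup S y)      ∎)
  where
  open ≡-Reasoning
  y : Fin (suc (suc n))
  y = punchIn x zero

≡⊎mismatch : (B S : Subset n) → B ≡ S ⊎ ∃[ x ] lookup B x ≢ lookup S x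
≡⊎mismatch B S with all? (λ x → lookup B x ≟ᵇ lookup S x)
... | no B≉S = inj₂ (¬∀⟶∃¬ _ _ (λ x → lookup B x ≟ᵇ lookup S x) B≉S)
... | yes B≗S = inj₁ (begin
  B                   ≡⟨ tabulate∘lookup B ⟨
  tabulate (lookup B) ≡⟨ tabulate-cong B≗S ⟩
  tabulate (lookup S) ≡⟨ tabulate∘lookup S ⟩
  S                   ∎)
  where open ≡-Reasoning

agreement : Subset n → Subset n → ℕ
agreement []          []          = 0
agreement (true  ∷ B) (true  ∷ T) = suc (agreement B T)
agreement (false ∷ B) (false ∷ T) = suc (agreement B T)
agreement (true  ∷ B) (false ∷ T) = agreement B T
agreement (false ∷ B) (true  ∷ T) = agreement B T

∣∩∣+∣∁∩∁∣≡agreement : (B T : Subset n) → ∣ B ∩ T ∣ + ∣ ∁ B ∩ ∁ T ∣ ≡ agreement B T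
∣∩∣+∣∁∩∁∣≡agreement []          []          = refl
∣∩∣+∣∁∩∁∣≡agreement (true  ∷ B) (true  ∷ T) = cong suc (∣∩∣+∣∁∩∁∣≡agreement B T)
∣∩∣+∣∁∩∁∣≡agreement (false ∷ B) (false ∷ T) =
  trans (+-suc _ _) (cong suc (∣∩∣+∣∁∩∁∣≡agreement B T))
∣∩∣+∣∁∩∁∣≡agreement (true  ∷ B) (false ∷ T) = ∣∩∣+∣∁∩∁∣≡agreement B T
∣∩∣+∣∁∩∁∣≡agreement (false ∷ B) (true  ∷ T) = ∣∩∣+∣∁∩∁∣≡agreement B T

agreement-toggle-mismatch : (x : Fin n) (B T : Subset n) → lookup B x ≢ lookup T x →
                            agreement B (toggle x T) ≡ suc (agreement B T)
agreement-toggle-mismatch zero    (true  ∷ B) (true  ∷ T) b≢t = contradiction refl b≢t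
agreement-toggle-mismatch zero    (false ∷ B) (false ∷ T) b≢t = contradiction refl b≢t
agreement-toggle-mismatch zero    (true  ∷ B) (false ∷ T) _   = refl
agreement-toggle-mismatch zero    (false ∷ B) (true  ∷ T) _   = refl
agreement-toggle-mismatch (suc x) (true  ∷ B) (true  ∷ T) b≢t =
  cong suc (agreement-toggle-mismatch x B T b≢t)
agreement-toggle-mismatch (suc x) (false ∷ B) (false ∷ T) b≢t =
  cong suc (agreement-toggle-mismatch x B T b≢t)
agreement-toggle-mismatch (suc x) (true  ∷ B) (false ∷ T) b≢t = agreement-toggle-mismatch x B T b≢t
agreement-toggle-mismatch (suc x) (false ∷ B) (true  ∷ T) b≢t = agreement-toggle-mismatch x B T b≢t

-- If B and T agree at x, then B and toggle x T disagree there, and toggling back gains one.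
agreement-toggle-≤ : (x : Fin n) (B T : Subset n) → agreement B T ≤ suc (agreement B (toggle x T))
agreement-toggle-≤ x B T with lookup B x ≟ᵇ lookup T x
... | no b≢t = begin
  agreement B T                    ≤⟨ n≤1+n _ ⟩
  suc (agreement B T)              ≡⟨ agreement-toggle-mismatch x B T b≢t ⟨
  agreement B (toggle x T)         ≤⟨ n≤1+n _ ⟩
  suc (agreement B (toggle x T))   ∎
  where open ≤-Reasoning
... | yes b≡t = ≤-reflexive (begin
  agreement B T                         ≡⟨ cong (agreement B) (toggle-involutive x T) ⟨
  agreement B (toggle x (toggle x T))   ≡⟨ agreement-toggle-mismatch x B (toggle x T) b≢t′ ⟩
  suc (agreement B (toggle x T))        ∎)
  where
  open ≡-Reasoning
  b≢t′ : lookup B x ≢ lookup (toggle x T) x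
  b≢t′ = subst (lookup B x ≢_) (sym (lookup∘updateAt x T)) (not-¬ b≡t)

agreement≤rank : ∀ {F : Family n} {B} S → B ∈ F → agreement B S ≤ rank F S
agreement≤rank {B = B} S (here refl) =
  ≤-trans (≤-reflexive (sym (∣∩∣+∣∁∩∁∣≡agreement B S))) (m≤m⊔n _ _)
agreement≤rank S (there B∈F) = ≤-trans (agreement≤rank S B∈F) (m≤n⊔m _ _)

rank-attained : (C : Subset n) (F : Family n) (S : Subset n) →
                ∃[ B ] (B ∈ C ∷ F × rank (C ∷ F) S ≡ agreement B S)
rank-attained C []      S = C , here refl , trans (⊔-identityʳ _) (∣∩∣+∣∁∩∁∣≡agreement C S)
rank-attained C (D ∷ F) S with ⊔-sel (∣ C ∩ S ∣ + ∣ ∁ C ∩ ∁ S ∣) (rank (D ∷ F) S)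
... | inj₁ r≡C = C , here refl , trans r≡C (∣∩∣+∣∁∩∁∣≡agreement C S)
... | inj₂ r≡F with rank-attained D F S
...   | B , B∈F , r≡B = B , there B∈F , trans r≡F r≡B

rank-toggle-≤ : (F : Family n) (x : Fin n) (S : Subset n) →
                rank F S ≤ suc (rank F (toggle x S))
rank-toggle-≤ []      x S = z≤n
rank-toggle-≤ (C ∷ F) x S with rank-attained C F S
... | B , B∈F , r≡B = begin
  rank (C ∷ F) S                    ≡⟨ r≡B ⟩
  agreement B S                     ≤⟨ agreement-toggle-≤ x B S ⟩
  suc (agreement B (toggle x S))    ≤⟨ s≤s (agreement≤rank (toggle x S) B∈F) ⟩
  suc (rank (C ∷ F) (toggle x S))   ∎
  where open ≤-Reasoning

module _ {F : Family n} {B : Subset n} (B∈F : B ∈ F) {S : Subset n}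
         (r≡B : rank F S ≡ agreement B S) {x : Fin n} (B≢S : lookup B x ≢ lookup S x)
         where

  rank-toggle-mismatch : suc (rank F S) ≤ rank F (toggle x S)
  rank-toggle-mismatch = begin
    suc (rank F S)           ≡⟨ cong suc r≡B ⟩
    suc (agreement B S)      ≡⟨ agreement-toggle-mismatch x B S B≢S ⟨
    agreement B (toggle x S) ≤⟨ agreement≤rank (toggle x S) B∈F ⟩
    rank F (toggle x S)      ∎
    where open ≤-Reasoning

  rsum-toggle-mismatch : rsum F S ≤ rsum F (toggle x S)
  rsum-toggle-mismatch = s≤s⁻¹ (begin
    suc (rank F S) + rank F (∁ S)
      ≤⟨ +-monoˡ-≤ (rank F (∁ S)) rank-toggle-mismatch ⟩
    rank F (toggle x S) + rank F (∁ S)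
      ≤⟨ +-monoʳ-≤ (rank F (toggle x S)) (rank-toggle-≤ F x (∁ S)) ⟩
    rank F (toggle x S) + suc (rank F (toggle x (∁ S)))
      ≡⟨ cong (λ T → rank F (toggle x S) + suc (rank F T)) (∁-toggle x S) ⟨
    rank F (toggle x S) + suc (rank F (∁ (toggle x S)))
      ≡⟨ +-suc _ _ ⟩
    suc (rsum F (toggle x S)) ∎)
    where open ≤-Reasoning

rsum-∁ : (F : Family n) (S : Subset n) → rsum F (∁ S) ≡ rsum F S
rsum-∁ F S = trans (cong (λ T → rank F (∁ S) + rank F T) (∁-involutive S))
                   (+-comm (rank F (∁ S)) (rank F S))

IsRsumMax : Family n → Subset n → Set
IsRsumMax F S = ∀ U → rsum F U ≤ rsum F S

∈⊎toggle-isRsumMax : (F : Family (suc n)) (S : Subset (suc n)) → IsRsumMax F S →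
                     S ∈ F ⊎ ∃[ x ] IsRsumMax F (toggle x S)
∈⊎toggle-isRsumMax []      S _   = inj₂ (zero , λ _ → z≤n)
∈⊎toggle-isRsumMax (C ∷ F) S max with rank-attained C F S
... | B , B∈F , r≡B with ≡⊎mismatch B S
...   | inj₁ refl         = inj₁ B∈F
...   | inj₂ (x , B≢S) = inj₂ (x , λ U → ≤-trans (max U) (rsum-toggle-mismatch B∈F r≡B B≢S))

uniqueRsumMax-∈ : (F : Family (suc (suc n))) (S : Subset (suc (suc n))) → IsRsumMax F S →
                  (∀ T → IsRsumMax F T → T ≡ S ⊎ T ≡ ∁ S) → S ∈ F
uniqueRsumMax-∈ F S max unique with ∈⊎toggle-isRsumMax F S max
... | inj₁ S∈F       = S∈F
... | inj₂ (x , max′) with unique (toggle x S) max′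
...   | inj₁ eq = contradiction eq (toggle≢ x S)
...   | inj₂ eq = contradiction eq (toggle≢∁ x S)

lemma4p2 : (n : ℕ) → 3 ≤ n → (F : Family n) → IsDeltaMatroid F →
    (S : Subset n) →
    (∀ U → rsum F U ≤ rsum F S) →
    (∀ T → (∀ U → rsum F U ≤ rsum F T) → (T ≡ S ⊎ T ≡ ∁ S)) →
    (S ∈ F) × (∁ S ∈ F)
lemma4p2 _ (s≤s (s≤s _)) F _ S max unique =
  uniqueRsumMax-∈ F S max unique , uniqueRsumMax-∈ F (∁ S) max∁ unique∁
  where
  max∁ : IsRsumMax F (∁ S)
  max∁ U = subst (rsum F U ≤_) (sym (rsum-∁ F S)) (max U)
  unique∁ : ∀ T → IsRsumMax F T → T ≡ ∁ S ⊎ T ≡ ∁ (∁ S)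
  unique∁ T maxT = swap (map₁ (λ T≡S → trans T≡S (sym (∁-involutive S))) (unique T maxT))
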